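{- In every modal model (as defined in the context) and for all concepts $A,B,C$, the following mixed apodictic–assertoric inferences are valid (whenever the premises hold, the conclusion holds): First figure: (Barbara NXN) $N(BaA),\ CaB\ \vdash N(CaA)$; (Celarent NXN) $N(BeA),\ CaB\vdash N(CeA)$; (Darii NXN) $N(BaA),\ CiB\vdash N(CiA)$; (Ferio NXN) $N(BeA),\ CiB\vdash N(CoA)$. Second figure: (Cesare NXN) $N(BeA),\ CaA\vdash N(CeB)$; (Camestres XNN) $BaA,\ N(CeA)\vdash N(CeB)$; (Festino NXN) $N(BeA),\ CiA\vdash N(CoB)$. Third figure: (Darapti NXN) $N(CaA),\ CaB\vdash N(BiA)$ and (Darapti XNN) $CaA,\ N(CaB)\vdash N(BiA)$, both under the assumption that $C$ is nonempty; (Felapton NXN) $N(CeA),\ CaB\vdash N(BoA)$, under the assumption that $C$ is nonempty; (Datisi NXN) $N(CaA),\ CiB\vdash N(BiA)$; (Disamis XNN) $CiA,\ N(CaB)\vdash N(BiA)$; (Ferison NXN) $N(CeA),\ CiB\vdash N(BoA)$.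
   Context: A modal model consists of: a set $T$ with a distinguished element $t_0\in T$; for each $t\in T$ a set $W_t$; a collection of concepts, where a concept $A$ is a family $(A_t)_{t\in T}$ with $A_t\subseteq W_t$; and a set $I$ of individuals, where an individual $x$ is a function on $T$ with $x_t\in W_t$. Quantifiers range over $I$; a concept $C$ is nonempty if $\exists x\, Cx$. Interpretation: $Ax$ iff $x_{t_0}\in A_{t_0}$; $N(Ax)$ iff $x_t\in A_t$ for all $t$; $N(x\neq y)$ iff $x_t\neq y_t$ for all $t$. Assertoric: $BaA:\iff\forall x(Bx\Rightarrow Ax)$; $BeA:\iff\forall x(Bx\Rightarrow\neg Ax)$; $BiA:\iff\exists x(Bx\wedge Ax)$; $BoA:\iff\exists x(Bx\wedge\neg Ax)$. Apodictic: $N(BaA):\iff\forall x(Bx\Rightarrow N(Ax))$; $N(BeA):\iff\forall x[Bx\Rightarrow\forall y(Ay\Rightarrow N(x\neq y))]$; $N(BiA):\iff\exists x(Bx\wedge N(Ax))\vee\exists x(N(Bx)\wedge Ax)$; $N(BoA):\iff\exists x[Bx\wedge\forall y(Ay\Rightarrow N(x\neq y))]\vee\exists x[N(Bx)\wedge\neg Ax\wedge\forall y(N(Ay)\Rightarrow N(x\neq y))]$. -}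

module Defs where

open import Level using (Level; _⊔_; suc)
open import Data.Product using (Σ; _×_; _,_; ∃-syntax)
open import Data.Sum using (_⊎_)
open import Relation.Nullary using (¬_)
open import Relation.Binary.PropositionalEquality using (_≡_)

-- A modal model: index set T with distinguished t₀, sets W t,
-- a collection of concepts (families A t ⊆ W t, subsets as predicates),
-- and a set of individuals (dependent functions x with x t ∈ W t).
record ModalModel (ℓ : Level) : Set (suc ℓ) where
  field
    T         : Set ℓ
    t₀        : T
    W         : T → Set ℓ
    IsConcept : ((t : T) → W t → Set ℓ) → Set ℓ
    IsIndiv   : ((t : T) → W t) → Set ℓ

module _ {ℓ : Level} (M : ModalModel ℓ) where
  open ModalModel M

  Concept : Set (suc ℓ)
  Concept = Σ ((t : T) → W t → Set ℓ) IsConcept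


  Ind : Set ℓ
  Ind = Σ ((t : T) → W t) IsIndiv

  pt : Ind → (t : T) → W t
  pt (x , _) = x

  ext : Concept → (t : T) → W t → Set ℓ
  ext (A , _) = A

  holds : Concept → Ind → Set ℓ
  holds A x = ext A t₀ (pt x t₀)

  Nholds : Concept → Ind → Set ℓ
  Nholds A x = (t : T) → ext A t (pt x t)

  Ndistinct : Ind → Ind → Set ℓ
  Ndistinct x y = (t : T) → ¬ (pt x t ≡ pt y t)

  Nonempty : Concept → Set ℓ
  Nonempty C = ∃[ x ] holds C x

  -- assertoric propositions (subject B, predicate A)
  Xa : Concept → Concept → Set ℓ
  Xa B A = ∀ x → holds B x → holds A x

  Xe : Concept → Concept → Set ℓ
  Xe B A = ∀ x → holds B x → ¬ holds A x

  Xi : Concept → Concept → Set ℓ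
  Xi B A = ∃[ x ] (holds B x × holds A x)

  Xo : Concept → Concept → Set ℓ
  Xo B A = ∃[ x ] (holds B x × ¬ holds A x)

  Na : Concept → Concept → Set ℓ
  Na B A = ∀ x → holds B x → Nholds A x

  Ne : Concept → Concept → Set ℓ
  Ne B A = ∀ x → holds B x → ∀ y → holds A y → Ndistinct x y

  Ni : Concept → Concept → Set ℓ
  Ni B A = (∃[ x ] (holds B x × Nholds A x)) ⊎ (∃[ x ] (Nholds B x × holds A x))

  No : Concept → Concept → Set ℓ
  No B A =
    (∃[ x ] (holds B x × (∀ y → holds A y → Ndistinct x y)))
    ⊎ (∃[ x ] (Nholds B x × ¬ holds A x × (∀ y → Nholds A y → Ndistinct x y)))

{-# OPTIONS --safe #-}
module Submission where

open import Defs
open import Level using (Level)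
open import Data.Product using (_×_; _,_)
open import Data.Sum using (inj₁; inj₂)
open import Relation.Binary.PropositionalEquality using (sym)

-- The four first-figure moods are perfect: they hold directly from the
-- definitions. Every other mood reduces to one of them, as in Aristotle,
-- by simple conversion of e- and i-propositions: N(e) converts because
-- N(x ≠ y) is symmetric, N(i) because its two disjuncts are mirror images,
-- and X(i) trivially. Darapti and Felapton additionally need X(a) ⇒ X(i),
-- which is where the nonemptiness of the middle term C enters.

module _ {ℓ : Level} (M : ModalModel ℓ) where

  Ndistinct-sym : (x y : Ind M) → Ndistinct M x y → Ndistinct M y x
  Ndistinct-sym x y x≢y t y≡x = x≢y t (sym y≡x)

  Ne-sym : (A B : Concept M) → Ne M B A → Ne M A B
  Ne-sym A B ne y ay x bx = Ndistinct-sym x y (ne x bx y ay)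

  Xi-sym : (A B : Concept M) → Xi M B A → Xi M A B
  Xi-sym A B (x , bx , ax) = x , ax , bx

  Ni-sym : (A B : Concept M) → Ni M B A → Ni M A B
  Ni-sym A B (inj₁ (x , bx , nax)) = inj₂ (x , nax , bx)
  Ni-sym A B (inj₂ (x , nbx , ax)) = inj₁ (x , ax , nbx)

  Xa⇒Xi : (A B : Concept M) → Nonempty M B → Xa M B A → Xi M B A
  Xa⇒Xi A B (x , bx) xa = x , bx , xa x bx

  module _ (A B C : Concept M) where

    barbara-NXN : Na M B A → Xa M C B → Na M C A
    barbara-NXN na xa x cx = na x (xa x cx)

    celarent-NXN : Ne M B A → Xa M C B → Ne M C A
    celarent-NXN ne xa x cx = ne x (xa x cx)

    darii-NXN : Na M B A → Xi M C B → Ni M C A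
    darii-NXN na (x , cx , bx) = inj₁ (x , cx , na x bx)

    ferio-NXN : Ne M B A → Xi M C B → No M C A
    ferio-NXN ne (x , cx , bx) = inj₁ (x , cx , ne x bx)

  module _ (A B C : Concept M) where

    cesare-NXN : Ne M B A → Xa M C A → Ne M C B
    cesare-NXN ne = celarent-NXN B A C (Ne-sym A B ne)

    camestres-XNN : Xa M B A → Ne M C A → Ne M C B
    camestres-XNN xa ne = Ne-sym C B (celarent-NXN C A B (Ne-sym A C ne) xa)

    festino-NXN : Ne M B A → Xi M C A → No M C B
    festino-NXN ne = ferio-NXN B A C (Ne-sym A B ne)

    datisi-NXN : Na M C A → Xi M C B → Ni M B A
    datisi-NXN na xi = darii-NXN A C B na (Xi-sym B C xi)

    disamis-XNN : Xi M C A → Na M C B → Ni M B A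
    disamis-XNN xi na = Ni-sym B A (darii-NXN B C A na (Xi-sym A C xi))

    ferison-NXN : Ne M C A → Xi M C B → No M B A
    ferison-NXN ne xi = ferio-NXN A C B ne (Xi-sym B C xi)

    darapti-NXN : Nonempty M C → Na M C A → Xa M C B → Ni M B A
    darapti-NXN c na xa = datisi-NXN na (Xa⇒Xi B C c xa)

    darapti-XNN : Nonempty M C → Xa M C A → Na M C B → Ni M B A
    darapti-XNN c xa = disamis-XNN (Xa⇒Xi A C c xa)

    felapton-NXN : Nonempty M C → Ne M C A → Xa M C B → No M B A
    felapton-NXN c ne xa = ferison-NXN ne (Xa⇒Xi B C c xa)

mainTheorem4 : {ℓ : Level} (M : ModalModel ℓ) (A B C : Concept M) →
    -- first figure
    (Na M B A → Xa M C B → Na M C A)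
    × (Ne M B A → Xa M C B → Ne M C A)
    × (Na M B A → Xi M C B → Ni M C A)
    × (Ne M B A → Xi M C B → No M C A)
    -- second figure
    × (Ne M B A → Xa M C A → Ne M C B)
    × (Xa M B A → Ne M C A → Ne M C B)
    × (Ne M B A → Xi M C A → No M C B)
    -- third figure
    × (Nonempty M C → Na M C A → Xa M C B → Ni M B A)
    × (Nonempty M C → Xa M C A → Na M C B → Ni M B A)
    × (Nonempty M C → Ne M C A → Xa M C B → No M B A)
    × (Na M C A → Xi M C B → Ni M B A)
    × (Xi M C A → Na M C B → Ni M B A)
    × (Ne M C A → Xi M C B → No M B A)
mainTheorem4 M A B C =
    barbara-NXN M A B C , celarent-NXN M A B C
  , darii-NXN M A B C , ferio-NXN M A B C
  , cesare-NXN M A B C , camestres-XNN M A B C , festino-NXN M A B C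
  , darapti-NXN M A B C , darapti-XNN M A B C , felapton-NXN M A B C
  , datisi-NXN M A B C , disamis-XNN M A B C , ferison-NXN M A B C
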